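{- Let $n\ge4$. If there exists an $(n-2,2)$-factorisation of $K_{2n}$ whose index is coprime to $3$ (in particular, of index $1$), then $n\equiv0\pmod 3$.
   Context: A perfect matching of $K_{2n}$ is a set partition of $\{1,\dots,2n\}$ into pairs. An $(n-2,2)$-factorisation of index $c$ is a non-empty set $D$ of perfect matchings such that for every set partition $P$ of $\{1,\dots,2n\}$ into one block of size $2n-4$ and one block of size $4$, exactly $c$ matchings in $D$ refine $P$ (each edge lies within a block of $P$). -}

module Defs where

open import Data.Nat using (ℕ; _+_; _*_)
open import Data.Fin using (Fin)
open import Data.Fin.Subset using (Subset; _∈_; ∣_∣)
open import Data.Fin.Subset.Properties using (_∈?_)
open import Data.Fin.Properties using (all?)
open import Data.List using (List; length; filter)
open import Data.List.Relation.Unary.AllPairs using (AllPairs)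
open import Data.Product using (_×_)
open import Relation.Binary.PropositionalEquality using (_≡_; _≢_)
open import Relation.Nullary using (¬_; Dec)
open import Relation.Nullary.Decidable using (_×-dec_; _→-dec_)

-- A perfect matching of K_m on vertex set Fin m, encoded as its partner map:
-- a fixed-point-free involution (x is matched with partner x).
record Matching (m : ℕ) : Set where
  field
    partner    : Fin m → Fin m
    involutive : ∀ x → partner (partner x) ≡ x
    noFixed    : ∀ x → partner x ≢ x
open Matching public

SameMatching : ∀ {m} → Matching m → Matching m → Set
SameMatching M N = ∀ x → partner M x ≡ partner N x

-- A set partition of Fin m into a block of size 4 and a block of size m - 4,
-- given by the 4-element block A (the other block is its complement).
record Split4 (m : ℕ) : Set where
  field
    block  : Subset m
    size4  : ∣ block ∣ ≡ 4
open Split4 public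

Refines : ∀ {m} → Matching m → Subset m → Set
Refines M A = ∀ x → ((x ∈ A) → (partner M x ∈ A)) × ((partner M x ∈ A) → (x ∈ A))

refines? : ∀ {m} (M : Matching m) (A : Subset m) → Dec (Refines M A)
refines? M A = all? (λ x → ((x ∈? A) →-dec (partner M x ∈? A)) ×-dec ((partner M x ∈? A) →-dec (x ∈? A)))

countRefining : ∀ {m} → List (Matching m) → Subset m → ℕ
countRefining D A = length (filter (λ M → refines? M A) D)

-- An (n-2,2)-factorisation of K_{2n} of index c: a non-empty set D
-- (list without repetitions) of perfect matchings such that every
-- partition into blocks of sizes 2n-4 and 4 is refined by exactly c of them.
record Factorisation (n c : ℕ) : Set where
  field
    matchings : List (Matching (2 * n))
    distinct  : AllPairs (λ M N → ¬ SameMatching M N) matchings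
    nonEmpty  : 0 Data.Nat.< length matchings
    index     : ∀ (P : Split4 (2 * n)) → countRefining matchings (block P) ≡ c

-- Fix five vertices. For distinct vertices x, y, z, a matching refines the partition with
-- 4-block {x, y, z, v} (v outside {x, y, z}) for exactly one v when it has an edge inside
-- {x, y, z} (v is then the partner of the third vertex), and for no v otherwise. Summing over
-- the ten triples of the five vertices counts each edge among them three times, so every
-- matching refines a multiple of 3 of these 4-blocks. Counted block by block instead, the
-- total is 10 (2n - 3) c; hence 3 divides (2n - 3) c, and 3 ∤ c forces 3 ∣ n.

module Submission where

open import Defs
open import Data.Bool using (true; false; if_then_else_)
open import Data.Empty using (⊥-elim)
open import Data.Fin as Fin using (Fin; #_)
open import Data.Fin.Properties using (_≟_)
open import Data.Fin.Subset using (Subset; _∈_; _∉_; ∣_∣; ⁅_⁆; _∪_; ∁; inside; outside)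
open import Data.Fin.Subset.Properties
  using ( _∈?_; x∈⁅x⁆; x∈⁅y⁆⇒x≡y; ∣⁅x⁆∣≡1; x∈p∪q⁻; x∈p∪q⁺; ∪-identityˡ; ∪-comm; ∪-assoc
        ; x∈∁p⇒x∉p; x∉p⇒x∈∁p; ∣∁p∣≡n∸∣p∣ )
open import Data.List using (List; []; _∷_; map; length; filter; allFin; tabulate)
open import Data.List.Properties using (map-tabulate)
open import Data.List.Membership.Propositional using () renaming (_∈_ to _∈ₗ_)
open import Data.List.Membership.Propositional.Properties using (∈-allFin; ∈-filter⁺)
open import Data.List.Relation.Unary.All as All using (All; []; _∷_; all?)
open import Data.List.Relation.Unary.All.Properties using (all-filter)
open import Data.List.Relation.Unary.AllPairs using (_∷_)
open import Data.List.Relation.Unary.Any using (here; there)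
open import Data.List.Relation.Unary.Unique.Propositional using (Unique)
import Data.List.Relation.Unary.Unique.Propositional.Properties as Unique
open import Data.Nat using (ℕ; suc; _+_; _*_; _∸_; _≤_; _≤?_; s≤s)
open import Data.Nat.Coprimality using (Coprime; coprime?; coprime-divisor)
import Data.Nat.Coprimality as Coprimality
open import Data.Nat.Divisibility using (_∣_; divides; ∣-refl; ∣m∣n⇒∣m+n; ∣m∸n∣n⇒∣m)
open import Data.Nat.Properties using (*-zeroʳ; *-comm; *-monoʳ-≤; ≤-trans)
open import Data.Nat.Tactic.RingSolver using (solve-∀)
open import Data.Product using (_×_; _,_; proj₁)
open import Data.Sum using (_⊎_; inj₁; inj₂)
open import Data.Vec using ([]; _∷_; here; there)
open import Function using (_∘_; id)
open import Relation.Binary.PropositionalEquality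
  using (_≡_; _≢_; ≢-sym; refl; sym; trans; cong; cong₂; subst; module ≡-Reasoning)
open import Relation.Nullary using (¬_; Dec; yes; no; does; ¬?)
open import Relation.Nullary.Decidable using (from-yes; _×-dec_)

private
  variable
    A : Set
    m : ℕ

-- Defined through does, like filter, so that countRefining-∑ can split on does (refines? M A).
𝟙 : {P : Set} → Dec P → ℕ
𝟙 d = if does d then 1 else 0

𝟙-no : {P : Set} → ¬ P → (d : Dec P) → 𝟙 d ≡ 0
𝟙-no ¬p (yes p) = ⊥-elim (¬p p)
𝟙-no ¬p (no _)  = refl

𝟙-cong : {P Q : Set} → (P → Q) → (Q → P) → (d : Dec P) (e : Dec Q) → 𝟙 d ≡ 𝟙 e
𝟙-cong f g (yes p) (yes q) = refl
𝟙-cong f g (yes p) (no ¬q) = ⊥-elim (¬q (f p))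
𝟙-cong f g (no ¬p) (yes q) = ⊥-elim (¬p (g q))
𝟙-cong f g (no ¬p) (no ¬q) = refl

∑ : List A → (A → ℕ) → ℕ
∑ []       f = 0
∑ (x ∷ xs) f = f x + ∑ xs f

syntax ∑ xs (λ x → e) = ∑[ x ∈ xs ] e

∑-cong : (xs : List A) {f g : A → ℕ} → (∀ x → f x ≡ g x) → ∑ xs f ≡ ∑ xs g
∑-cong []       f≡g = refl
∑-cong (x ∷ xs) f≡g = cong₂ _+_ (f≡g x) (∑-cong xs f≡g)

∑-cong-All : {P : A → Set} {f g : A → ℕ} {xs : List A} →
             (∀ {x} → P x → f x ≡ g x) → All P xs → ∑ xs f ≡ ∑ xs g
∑-cong-All f≡g []         = refl
∑-cong-All f≡g (px ∷ pxs) = cong₂ _+_ (f≡g px) (∑-cong-All f≡g pxs)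

∑-const : (xs : List A) (k : ℕ) → ∑[ _ ∈ xs ] k ≡ length xs * k
∑-const []       k = refl
∑-const (x ∷ xs) k = cong (k +_) (∑-const xs k)

∑-zero : (xs : List A) → ∑[ _ ∈ xs ] 0 ≡ 0
∑-zero xs = trans (∑-const xs 0) (*-zeroʳ (length xs))

∑-+ : (xs : List A) (f g : A → ℕ) → ∑[ x ∈ xs ] (f x + g x) ≡ ∑ xs f + ∑ xs g
∑-+ []       f g = refl
∑-+ (x ∷ xs) f g rewrite ∑-+ xs f g = interchange (f x) (g x) (∑ xs f) (∑ xs g)
  where
  interchange : ∀ a b c d → a + b + (c + d) ≡ a + c + (b + d)
  interchange = solve-∀

∑-swap : (xs : List A) {B : Set} (ys : List B) (f : A → B → ℕ) →
         ∑[ x ∈ xs ] ∑[ y ∈ ys ] f x y ≡ ∑[ y ∈ ys ] ∑[ x ∈ xs ] f x y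
∑-swap []       ys f = sym (∑-zero ys)
∑-swap (x ∷ xs) ys f = begin
  ∑ ys (f x) + ∑[ x ∈ xs ] ∑[ y ∈ ys ] f x y ≡⟨ cong (∑ ys (f x) +_) (∑-swap xs ys f) ⟩
  ∑ ys (f x) + ∑[ y ∈ ys ] ∑[ x ∈ xs ] f x y ≡⟨ ∑-+ ys (f x) (λ y → ∑[ x ∈ xs ] f x y) ⟨
  ∑[ y ∈ ys ] (f x y + ∑[ x ∈ xs ] f x y)    ∎
  where open ≡-Reasoning

∑-divisible : ∀ {d} (xs : List A) (f : A → ℕ) → (∀ x → d ∣ f x) → d ∣ ∑ xs f
∑-divisible []       f d∣f = divides 0 refl
∑-divisible (x ∷ xs) f d∣f = ∣m∣n⇒∣m+n (d∣f x) (∑-divisible xs f d∣f)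

occurrences : Fin m → List (Fin m) → ℕ
occurrences t xs = ∑[ v ∈ xs ] 𝟙 (t ≟ v)

occurrences-∉ : {t : Fin m} {xs : List (Fin m)} → All (t ≢_) xs → occurrences t xs ≡ 0
occurrences-∉ {t = t} {xs} t∉xs = trans (∑-cong-All (λ {v} t≢v → 𝟙-no t≢v (t ≟ v)) t∉xs) (∑-zero xs)

occurrences-unique : {t : Fin m} {xs : List (Fin m)} → Unique xs → t ∈ₗ xs → occurrences t xs ≡ 1
occurrences-unique {t = t} (x∉xs ∷ _) (here refl) with t ≟ t
... | yes _  = cong suc (occurrences-∉ x∉xs)
... | no t≢t = ⊥-elim (t≢t refl)
occurrences-unique {t = t} {x ∷ _} (x∉xs ∷ uniq) (there t∈xs) =
  cong₂ _+_ (𝟙-no (λ t≡x → All.lookup x∉xs t∈xs (sym t≡x)) (t ≟ x)) (occurrences-unique uniq t∈xs)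

others : Subset m → List (Fin m)
others T = filter (_∈? ∁ T) (allFin _)

others-∉ : (T : Subset m) → All (_∉ T) (others T)
others-∉ T = All.map x∈∁p⇒x∉p (all-filter (_∈? ∁ T) (allFin _))

occurrences-others : (T : Subset m) {t : Fin m} → t ∉ T → occurrences t (others T) ≡ 1
occurrences-others T t∉T =
  occurrences-unique (Unique.filter⁺ (_∈? ∁ T) (Unique.allFin⁺ _)) (∈-filter⁺ (_∈? ∁ T) (∈-allFin _) (x∉p⇒x∈∁p t∉T))

length-filter-∈-map-suc : ∀ s (p : Subset m) (xs : List (Fin m)) →
  length (filter (_∈? (s ∷ p)) (map Fin.suc xs)) ≡ length (filter (_∈? p) xs)
length-filter-∈-map-suc s p []       = refl
length-filter-∈-map-suc s p (x ∷ xs) with x ∈? p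
... | yes _ = cong suc (length-filter-∈-map-suc s p xs)
... | no _  = length-filter-∈-map-suc s p xs

length-filter-∈-allFin-suc : ∀ s (p : Subset m) → length (filter (_∈? (s ∷ p)) (tabulate Fin.suc)) ≡ ∣ p ∣
length-filter-∈-allFin : (p : Subset m) → length (filter (_∈? p) (allFin m)) ≡ ∣ p ∣
length-filter-∈-allFin []            = refl
length-filter-∈-allFin {suc m} (inside ∷ p)  = cong suc (length-filter-∈-allFin-suc inside p)
length-filter-∈-allFin {suc m} (outside ∷ p) = length-filter-∈-allFin-suc outside p

length-filter-∈-allFin-suc {m} s p = begin
  length (filter (_∈? (s ∷ p)) (tabulate Fin.suc))       ≡⟨ cong (length ∘ filter (_∈? (s ∷ p))) (map-tabulate id Fin.suc) ⟨
  length (filter (_∈? (s ∷ p)) (map Fin.suc (allFin m))) ≡⟨ length-filter-∈-map-suc s p (allFin m) ⟩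
  length (filter (_∈? p) (allFin m))                     ≡⟨ length-filter-∈-allFin p ⟩
  ∣ p ∣                                                   ∎
  where open ≡-Reasoning

length-others : (T : Subset m) → length (others T) ≡ m ∸ ∣ T ∣
length-others T = trans (length-filter-∈-allFin (∁ T)) (∣∁p∣≡n∸∣p∣ T)

triple : Fin m → Fin m → Fin m → Subset m
triple x y z = ⁅ x ⁆ ∪ (⁅ y ⁆ ∪ ⁅ z ⁆)

tripleOf : Fin m × Fin m × Fin m → Subset m
tripleOf (x , y , z) = triple x y z

Distinct : Fin m × Fin m × Fin m → Set
Distinct (x , y , z) = x ≢ y × x ≢ z × y ≢ z

distinct? : (t : Fin m × Fin m × Fin m) → Dec (Distinct t)
distinct? (x , y , z) = ¬? (x ≟ y) ×-dec ¬? (x ≟ z) ×-dec ¬? (y ≟ z)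

∈-triple⁻ : {t x y z : Fin m} → t ∈ triple x y z → t ≡ x ⊎ t ≡ y ⊎ t ≡ z
∈-triple⁻ {x = x} {y} {z} t∈T with x∈p∪q⁻ ⁅ x ⁆ _ t∈T
... | inj₁ t∈x = inj₁ (x∈⁅y⁆⇒x≡y x t∈x)
... | inj₂ t∈yz with x∈p∪q⁻ ⁅ y ⁆ ⁅ z ⁆ t∈yz
...   | inj₁ t∈y = inj₂ (inj₁ (x∈⁅y⁆⇒x≡y y t∈y))
...   | inj₂ t∈z = inj₂ (inj₂ (x∈⁅y⁆⇒x≡y z t∈z))

∈-triple⁺ : {t x y z : Fin m} → t ≡ x ⊎ t ≡ y ⊎ t ≡ z → t ∈ triple x y z
∈-triple⁺ (inj₁ refl)        = x∈p∪q⁺ (inj₁ (x∈⁅x⁆ _))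
∈-triple⁺ (inj₂ (inj₁ refl)) = x∈p∪q⁺ (inj₂ (x∈p∪q⁺ (inj₁ (x∈⁅x⁆ _))))
∈-triple⁺ (inj₂ (inj₂ refl)) = x∈p∪q⁺ (inj₂ (x∈p∪q⁺ (inj₂ (x∈⁅x⁆ _))))

∉-triple : {t x y z : Fin m} → t ≢ x → t ≢ y → t ≢ z → t ∉ triple x y z
∉-triple t≢x t≢y t≢z t∈T with ∈-triple⁻ t∈T
... | inj₁ t≡x        = t≢x t≡x
... | inj₂ (inj₁ t≡y) = t≢y t≡y
... | inj₂ (inj₂ t≡z) = t≢z t≡z

triple-swap : (x y z : Fin m) → triple x y z ≡ triple x z y
triple-swap x y z = cong (⁅ x ⁆ ∪_) (∪-comm ⁅ y ⁆ ⁅ z ⁆)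

triple-rotate : (x y z : Fin m) → triple x y z ≡ triple y z x
triple-rotate x y z = begin
  ⁅ x ⁆ ∪ (⁅ y ⁆ ∪ ⁅ z ⁆) ≡⟨ ∪-comm ⁅ x ⁆ _ ⟩
  (⁅ y ⁆ ∪ ⁅ z ⁆) ∪ ⁅ x ⁆ ≡⟨ ∪-assoc ⁅ y ⁆ ⁅ z ⁆ ⁅ x ⁆ ⟩
  ⁅ y ⁆ ∪ (⁅ z ⁆ ∪ ⁅ x ⁆) ∎
  where open ≡-Reasoning

∣⁅x⁆∪p∣≡1+∣p∣ : (x : Fin m) (p : Subset m) → x ∉ p → ∣ ⁅ x ⁆ ∪ p ∣ ≡ suc ∣ p ∣
∣⁅x⁆∪p∣≡1+∣p∣ Fin.zero    (inside ∷ p)  x∉p = ⊥-elim (x∉p here)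
∣⁅x⁆∪p∣≡1+∣p∣ Fin.zero    (outside ∷ p) x∉p = cong (suc ∘ ∣_∣) (∪-identityˡ p)
∣⁅x⁆∪p∣≡1+∣p∣ (Fin.suc x) (inside ∷ p)  x∉p = cong suc (∣⁅x⁆∪p∣≡1+∣p∣ x p (x∉p ∘ there))
∣⁅x⁆∪p∣≡1+∣p∣ (Fin.suc x) (outside ∷ p) x∉p = ∣⁅x⁆∪p∣≡1+∣p∣ x p (x∉p ∘ there)

∣triple∣≡3 : {x y z : Fin m} → Distinct (x , y , z) → ∣ triple x y z ∣ ≡ 3
∣triple∣≡3 {x = x} {y} {z} (x≢y , x≢z , y≢z) = begin
  ∣ ⁅ x ⁆ ∪ (⁅ y ⁆ ∪ ⁅ z ⁆) ∣ ≡⟨ ∣⁅x⁆∪p∣≡1+∣p∣ x _ x∉yz ⟩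
  suc ∣ ⁅ y ⁆ ∪ ⁅ z ⁆ ∣       ≡⟨ cong suc (∣⁅x⁆∪p∣≡1+∣p∣ y _ (y≢z ∘ x∈⁅y⁆⇒x≡y z)) ⟩
  suc (suc ∣ ⁅ z ⁆ ∣)         ≡⟨ cong (suc ∘ suc) (∣⁅x⁆∣≡1 z) ⟩
  3                           ∎
  where
  open ≡-Reasoning
  x∉yz : x ∉ ⁅ y ⁆ ∪ ⁅ z ⁆
  x∉yz x∈yz with x∈p∪q⁻ ⁅ y ⁆ ⁅ z ⁆ x∈yz
  ... | inj₁ x∈y = x≢y (x∈⁅y⁆⇒x≡y y x∈y)
  ... | inj₂ x∈z = x≢z (x∈⁅y⁆⇒x≡y z x∈z)

x∈⁅y⁆∪p∧x∉p⇒x≡y : {x y : Fin m} {p : Subset m} → x ∈ ⁅ y ⁆ ∪ p → x ∉ p → x ≡ y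
x∈⁅y⁆∪p∧x∉p⇒x≡y {y = y} {p} x∈y∪p x∉p with x∈p∪q⁻ ⁅ y ⁆ p x∈y∪p
... | inj₁ x∈y = x∈⁅y⁆⇒x≡y y x∈y
... | inj₂ x∈p = ⊥-elim (x∉p x∈p)

module _ (M : Matching m) where

  partner-sym : {a b : Fin m} → partner M a ≡ b → partner M b ≡ a
  partner-sym {a} refl = involutive M a

  partner-escapes-triple : {a b c : Fin m} → partner M a ≡ b → c ≢ a → c ≢ b → partner M c ∉ triple a b c
  partner-escapes-triple {a} {b} {c} ab c≢a c≢b =
    ∉-triple (λ ca → c≢b (trans (sym (partner-sym ca)) ab))
             (λ cb → c≢a (trans (sym (partner-sym cb)) (partner-sym ab)))
             (noFixed M c)

  refines-closed : {A : Subset m} → (∀ t → t ∈ A → partner M t ∈ A) → Refines M A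
  refines-closed {A} closed t = closed t , λ pt∈A → subst (_∈ A) (involutive M t) (closed _ pt∈A)

  refines⇒partner : {a b c d : Fin m} → partner M a ≡ b → c ≢ a → c ≢ b →
                    Refines M (⁅ d ⁆ ∪ triple a b c) → partner M c ≡ d
  refines⇒partner ab c≢a c≢b ref =
    x∈⁅y⁆∪p∧x∉p⇒x≡y (proj₁ (ref _) (x∈p∪q⁺ (inj₂ (∈-triple⁺ (inj₂ (inj₂ refl))))))
            (partner-escapes-triple ab c≢a c≢b)

  partner⇒refines : {a b c d : Fin m} → partner M a ≡ b → partner M c ≡ d → Refines M (⁅ d ⁆ ∪ triple a b c)
  partner⇒refines {a} {b} {c} {d} ab cd = refines-closed closed
    where
    closed : ∀ t → t ∈ ⁅ d ⁆ ∪ triple a b c → partner M t ∈ ⁅ d ⁆ ∪ triple a b c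
    closed t t∈A with x∈p∪q⁻ ⁅ d ⁆ _ t∈A
    ... | inj₁ t∈d = x∈p∪q⁺ (inj₂ (∈-triple⁺ (inj₂ (inj₂ (partner-sym (trans cd (sym (x∈⁅y⁆⇒x≡y d t∈d))))))))
    ... | inj₂ t∈T with ∈-triple⁻ t∈T
    ...   | inj₁ refl        = x∈p∪q⁺ (inj₂ (∈-triple⁺ (inj₂ (inj₁ ab))))
    ...   | inj₂ (inj₁ refl) = x∈p∪q⁺ (inj₂ (∈-triple⁺ (inj₁ (partner-sym ab))))
    ...   | inj₂ (inj₂ refl) = x∈p∪q⁺ (inj₁ (subst (_∈ ⁅ d ⁆) (sym cd) (x∈⁅x⁆ d)))

  ¬refines-without-edge : {a b c d : Fin m} → a ≢ b → partner M a ≢ b → partner M a ≢ c → partner M b ≢ c →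
                          ¬ Refines M (⁅ d ⁆ ∪ triple a b c)
  ¬refines-without-edge {a} {b} {c} {d} a≢b ¬ab ¬ac ¬bc ref = a≢b (begin
    a                      ≡⟨ involutive M a ⟨
    partner M (partner M a) ≡⟨ cong (partner M) (trans a↦d (sym b↦d)) ⟩
    partner M (partner M b) ≡⟨ involutive M b ⟩
    b                      ∎)
    where
    open ≡-Reasoning
    a↦d : partner M a ≡ d
    a↦d = x∈⁅y⁆∪p∧x∉p⇒x≡y (proj₁ (ref a) (x∈p∪q⁺ (inj₂ (∈-triple⁺ (inj₁ refl)))))
                          (∉-triple (noFixed M a) ¬ab ¬ac)
    b↦d : partner M b ≡ d
    b↦d = x∈⁅y⁆∪p∧x∉p⇒x≡y (proj₁ (ref b) (x∈p∪q⁺ (inj₂ (∈-triple⁺ (inj₂ (inj₁ refl))))))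
                          (∉-triple (¬ab ∘ partner-sym) (noFixed M b) ¬bc)

  extensionsRefined : Subset m → ℕ
  extensionsRefined T = ∑[ v ∈ others T ] 𝟙 (refines? M (⁅ v ⁆ ∪ T))

  edge : Fin m → Fin m → ℕ
  edge x y = 𝟙 (partner M x ≟ y)

  edgesWithin : Fin m × Fin m × Fin m → ℕ
  edgesWithin (x , y , z) = edge x y + edge x z + edge y z

  extensionsRefined-with-edge : {a b c : Fin m} → partner M a ≡ b → c ≢ a → c ≢ b →
                                extensionsRefined (triple a b c) ≡ 1
  extensionsRefined-with-edge {a} {b} {c} ab c≢a c≢b = begin
    extensionsRefined (triple a b c)                   ≡⟨ ∑-cong (others (triple a b c)) refines≡partner ⟩
    occurrences (partner M c) (others (triple a b c)) ≡⟨ occurrences-others _ (partner-escapes-triple ab c≢a c≢b) ⟩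
    1                                                  ∎
    where
    open ≡-Reasoning
    refines≡partner : ∀ v → 𝟙 (refines? M (⁅ v ⁆ ∪ triple a b c)) ≡ 𝟙 (partner M c ≟ v)
    refines≡partner v = 𝟙-cong (refines⇒partner ab c≢a c≢b) (partner⇒refines ab) (refines? M _) (partner M c ≟ v)

  extensionsRefined-without-edge : {a b c : Fin m} → a ≢ b → partner M a ≢ b → partner M a ≢ c → partner M b ≢ c →
                                   extensionsRefined (triple a b c) ≡ 0
  extensionsRefined-without-edge {a} {b} {c} a≢b ¬ab ¬ac ¬bc = trans
    (∑-cong (others (triple a b c)) λ v →
      𝟙-no (¬refines-without-edge a≢b ¬ab ¬ac ¬bc) (refines? M (⁅ v ⁆ ∪ triple a b c)))
    (∑-zero (others (triple a b c)))

  extensionsRefined-triple : {x y z : Fin m} → Distinct (x , y , z) →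
                             extensionsRefined (triple x y z) ≡ edgesWithin (x , y , z)
  extensionsRefined-triple {x} {y} {z} (x≢y , x≢z , y≢z)
    with partner M x ≟ y | partner M x ≟ z | partner M y ≟ z
  ... | yes xy | yes xz | _      = ⊥-elim (y≢z (trans (sym xy) xz))
  ... | yes xy | no _   | yes yz = ⊥-elim (x≢z (trans (sym (partner-sym xy)) yz))
  ... | no _   | yes xz | yes yz = ⊥-elim (x≢y (trans (sym (partner-sym xz)) (partner-sym yz)))
  ... | yes xy | no _   | no _   = extensionsRefined-with-edge xy (≢-sym x≢z) (≢-sym y≢z)
  ... | no _   | yes xz | no _   =
    subst (λ T → extensionsRefined T ≡ 1) (sym (triple-swap x y z)) (extensionsRefined-with-edge xz (≢-sym x≢y) y≢z)
  ... | no _   | no _   | yes yz =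
    subst (λ T → extensionsRefined T ≡ 1) (sym (triple-rotate x y z)) (extensionsRefined-with-edge yz x≢y x≢z)
  ... | no ¬xy | no ¬xz | no ¬yz = extensionsRefined-without-edge x≢y ¬xy ¬xz ¬yz

HasIndex : List (Matching m) → ℕ → Set
HasIndex {m} D c = (P : Split4 m) → countRefining D (block P) ≡ c

countRefining-∑ : (D : List (Matching m)) (A : Subset m) → countRefining D A ≡ ∑[ M ∈ D ] 𝟙 (refines? M A)
countRefining-∑ []      A = refl
countRefining-∑ (M ∷ D) A with does (refines? M A)
... | true  = cong suc (countRefining-∑ D A)
... | false = countRefining-∑ D A

∑-extensionsRefined : (D : List (Matching m)) {c : ℕ} → HasIndex D c →
                      (T : Subset m) → ∣ T ∣ ≡ 3 → ∑[ M ∈ D ] extensionsRefined M T ≡ (m ∸ 3) * c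
∑-extensionsRefined {m} D {c} index T ∣T∣≡3 = begin
  ∑[ M ∈ D ] ∑[ v ∈ others T ] 𝟙 (refines? M (⁅ v ⁆ ∪ T)) ≡⟨ ∑-swap D (others T) _ ⟩
  ∑[ v ∈ others T ] ∑[ M ∈ D ] 𝟙 (refines? M (⁅ v ⁆ ∪ T)) ≡⟨ ∑-cong (others T) (λ v → sym (countRefining-∑ D (⁅ v ⁆ ∪ T))) ⟩
  ∑[ v ∈ others T ] countRefining D (⁅ v ⁆ ∪ T)           ≡⟨ ∑-cong-All count≡c (others-∉ T) ⟩
  ∑[ v ∈ others T ] c                                     ≡⟨ ∑-const (others T) c ⟩
  length (others T) * c                                   ≡⟨ cong (_* c) (trans (length-others T) (cong (m ∸_) ∣T∣≡3)) ⟩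
  (m ∸ 3) * c                                             ∎
  where
  open ≡-Reasoning
  count≡c : {v : Fin m} → v ∉ T → countRefining D (⁅ v ⁆ ∪ T) ≡ c
  count≡c {v} v∉T = index (record { block = ⁅ v ⁆ ∪ T ; size4 = trans (∣⁅x⁆∪p∣≡1+∣p∣ v T v∉T) (cong suc ∣T∣≡3) })

triplesOfFive : {r : ℕ} → List (Fin (5 + r) × Fin (5 + r) × Fin (5 + r))
triplesOfFive = (# 0 , # 1 , # 2) ∷ (# 0 , # 1 , # 3) ∷ (# 0 , # 1 , # 4) ∷ (# 0 , # 2 , # 3) ∷ (# 0 , # 2 , # 4) ∷
                (# 0 , # 3 , # 4) ∷ (# 1 , # 2 , # 3) ∷ (# 1 , # 2 , # 4) ∷ (# 1 , # 3 , # 4) ∷ (# 2 , # 3 , # 4) ∷ []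

triplesOfFive-distinct : {r : ℕ} → All Distinct (triplesOfFive {r})
triplesOfFive-distinct = from-yes (all? distinct? triplesOfFive)

-- The left-hand side is ∑ triplesOfFive (edgesWithin M) unfolded.
each-pair-in-three-triples : ∀ e₀₁ e₀₂ e₀₃ e₀₄ e₁₂ e₁₃ e₁₄ e₂₃ e₂₄ e₃₄ →
  e₀₁ + e₀₂ + e₁₂ + (e₀₁ + e₀₃ + e₁₃ + (e₀₁ + e₀₄ + e₁₄ + (e₀₂ + e₀₃ + e₂₃ + (e₀₂ + e₀₄ + e₂₄ +
  (e₀₃ + e₀₄ + e₃₄ + (e₁₂ + e₁₃ + e₂₃ + (e₁₂ + e₁₄ + e₂₄ + (e₁₃ + e₁₄ + e₃₄ + (e₂₃ + e₂₄ + e₃₄ + 0)))))))))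
  ≡ 3 * (e₀₁ + e₀₂ + e₀₃ + e₀₄ + e₁₂ + e₁₃ + e₁₄ + e₂₃ + e₂₄ + e₃₄)
each-pair-in-three-triples = solve-∀

3∣∑-edgesWithin-triplesOfFive : {r : ℕ} (M : Matching (5 + r)) → 3 ∣ ∑ triplesOfFive (edgesWithin M)
3∣∑-edgesWithin-triplesOfFive M = divides edgesAmongFive (trans (each-pair-in-three-triples
  (e (# 0) (# 1)) (e (# 0) (# 2)) (e (# 0) (# 3)) (e (# 0) (# 4)) (e (# 1) (# 2))
  (e (# 1) (# 3)) (e (# 1) (# 4)) (e (# 2) (# 3)) (e (# 2) (# 4)) (e (# 3) (# 4))) (*-comm 3 edgesAmongFive))
  where
  e : Fin (5 + _) → Fin (5 + _) → ℕ
  e = edge M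
  edgesAmongFive : ℕ
  edgesAmongFive = e (# 0) (# 1) + e (# 0) (# 2) + e (# 0) (# 3) + e (# 0) (# 4) + e (# 1) (# 2)
                 + e (# 1) (# 3) + e (# 1) (# 4) + e (# 2) (# 3) + e (# 2) (# 4) + e (# 3) (# 4)

3∣10*[m∸3]*c : (D : List (Matching m)) {c : ℕ} → 5 ≤ m → HasIndex D c → 3 ∣ 10 * ((m ∸ 3) * c)
3∣10*[m∸3]*c {m} D {c} (s≤s (s≤s (s≤s (s≤s (s≤s _))))) index = subst (3 ∣_) double-count (∑-divisible D _ 3∣edges)
  where
  open ≡-Reasoning
  Ts : List (Fin m × Fin m × Fin m)
  Ts = triplesOfFive
  3∣edges : ∀ M → 3 ∣ ∑[ t ∈ Ts ] extensionsRefined M (tripleOf t)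
  3∣edges M = subst (3 ∣_) (sym (∑-cong-All (extensionsRefined-triple M) triplesOfFive-distinct))
                    (3∣∑-edgesWithin-triplesOfFive M)
  double-count : ∑[ M ∈ D ] ∑[ t ∈ Ts ] extensionsRefined M (tripleOf t) ≡ 10 * ((m ∸ 3) * c)
  double-count = begin
    ∑[ M ∈ D ] ∑[ t ∈ Ts ] extensionsRefined M (tripleOf t)
      ≡⟨ ∑-swap D Ts (λ M t → extensionsRefined M (tripleOf t)) ⟩
    ∑[ t ∈ Ts ] ∑[ M ∈ D ] extensionsRefined M (tripleOf t)
      ≡⟨ ∑-cong-All (λ {t} d → ∑-extensionsRefined D index (tripleOf t) (∣triple∣≡3 d)) triplesOfFive-distinct ⟩
    ∑[ t ∈ Ts ] ((m ∸ 3) * c)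
      ≡⟨ ∑-const Ts ((m ∸ 3) * c) ⟩
    10 * ((m ∸ 3) * c)
      ∎

mainTheorem7 : ∀ (n c : ℕ) → 4 ≤ n → Coprime c 3 → Factorisation n c → 3 ∣ n
mainTheorem7 n c 4≤n c⊥3 F = coprime-divisor (from-yes (coprime? 3 2)) 3∣2n
  where
  5≤2n : 5 ≤ 2 * n
  5≤2n = ≤-trans (from-yes (5 ≤? 8)) (*-monoʳ-≤ 2 4≤n)
  3∣[2n∸3]*c : 3 ∣ (2 * n ∸ 3) * c
  3∣[2n∸3]*c = coprime-divisor (from-yes (coprime? 3 10))
                 (3∣10*[m∸3]*c (Factorisation.matchings F) 5≤2n (Factorisation.index F))
  3∣2n∸3 : 3 ∣ 2 * n ∸ 3
  3∣2n∸3 = coprime-divisor (Coprimality.sym c⊥3) (subst (3 ∣_) (*-comm (2 * n ∸ 3) c) 3∣[2n∸3]*c)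
  3∣2n : 3 ∣ 2 * n
  3∣2n = ∣m∸n∣n⇒∣m 3 (≤-trans (from-yes (3 ≤? 5)) 5≤2n) 3∣2n∸3 ∣-refl
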